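{- Let $n$, $k$, $t$ and $s$ be positive integers with $k\geq t+1$ and $n\geq (t+1)(k-t+1)^{2}$. Suppose $\mathcal{F}\subseteq \binom{[n]}{k}$ is an $s$-almost $t$-intersecting family with $t+1\leq \tau_{t}(\mathcal{F})\leq k$. If $H$ is a subset of $[n]$ with $|H|< \tau_{t}(\mathcal{F})$, then $$|\mathcal{F}_{H}|\leq (k-t+1)^{\tau_{t}(\mathcal{F})-|H|}\binom{n-\tau_{t}(\mathcal{F})}{k-\tau_{t}(\mathcal{F})}+\sum_{i=0}^{\tau_{t}(\mathcal{F})-|H|-1}s(k-t+1)^{i}.$$
   Context: $\mathcal{F}\subseteq\binom{[n]}{k}$ (the $k$-subsets of $[n]=\{1,\dots,n\}$) is $s$-almost $t$-intersecting if $\left|\{F'\in\mathcal{F}: |F'\cap F|<t\}\right|\leq s$ for every $F\in\mathcal{F}$. A subset $T\subseteq[n]$ is a $t$-cover of $\mathcal{F}$ if $|T\cap F|\geq t$ for all $F\in\mathcal{F}$; the $t$-covering number $\tau_t(\mathcal{F})$ is the minimum size of a $t$-cover of $\mathcal{F}$. For $H\subseteq[n]$, $\mathcal{F}_H=\{F\in\mathcal{F}: H\subseteq F\}$. -}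

module Defs where

open import Data.Nat using (ℕ; zero; suc; _+_; _*_; _^_; _≤_; _<_; _<?_)
open import Data.Fin.Subset using (Subset; _∩_; ∣_∣)
open import Data.Fin.Subset.Properties using (_⊆?_)
open import Data.List using (List; filter; length)
open import Data.List.Relation.Unary.All using (All)
open import Data.List.Relation.Unary.Unique.Propositional using (Unique)
open import Data.List.Membership.Propositional using (_∈_)
open import Data.Product using (Σ; _×_)
open import Relation.Binary.PropositionalEquality using (_≡_)

KUniform : ∀ {n} → ℕ → List (Subset n) → Set
KUniform k 𝓕 = Unique 𝓕 × All (λ A → ∣ A ∣ ≡ k) 𝓕

badCount : ∀ {n} → ℕ → List (Subset n) → Subset n → ℕ
badCount t 𝓕 F = length (filter (λ F' → ∣ F' ∩ F ∣ <? t) 𝓕)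

AlmostIntersecting : ∀ {n} → ℕ → ℕ → List (Subset n) → Set
AlmostIntersecting s t 𝓕 = ∀ F → F ∈ 𝓕 → badCount t 𝓕 F ≤ s

IsTCover : ∀ {n} → ℕ → List (Subset n) → Subset n → Set
IsTCover t 𝓕 T = All (λ F → t ≤ ∣ T ∩ F ∣) 𝓕

IsTCoveringNumber : ∀ {n} → ℕ → List (Subset n) → ℕ → Set
IsTCoveringNumber {n} t 𝓕 τ =
  Σ (Subset n) (λ T → IsTCover t 𝓕 T × ∣ T ∣ ≡ τ)
  × (∀ T → IsTCover t 𝓕 T → τ ≤ ∣ T ∣)

restrict : ∀ {n} → List (Subset n) → Subset n → List (Subset n)
restrict 𝓕 H = filter (λ F → H ⊆? F) 𝓕

geomSum : ℕ → ℕ → ℕ → ℕ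
geomSum s q zero = 0
geomSum s q (suc m) = geomSum s q m + s * q ^ m

{-# OPTIONS --safe #-}
-- Induction on τ − |H|. If |H| = τ, every member of 𝓕_H is a k-superset of H,
-- and there are C(n − τ, k − τ) of those. If |H| < τ, then H is not a t-cover,
-- so some F₀ ∈ 𝓕 has |H ∩ F₀| < t, and F₀ has a set X of k − t + 1 points
-- outside H. A member F of 𝓕_H either meets F₀ in fewer than t points (at most
-- s such F, since 𝓕 is s-almost t-intersecting), or it cannot miss all of X,
-- as |F₀ ∖ X| = t − 1; then F ∈ 𝓕_{H ∪ {x}} for some x ∈ X. Hence
-- |𝓕_H| ≤ s + (k − t + 1) · max_x |𝓕_{H ∪ {x}}|, which unfolds to the bound.
module Submission where

open import Defs
open import Data.Nat using (ℕ; _+_; _*_; _∸_; _^_; _≤_; _<_)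
open import Data.Nat.Combinatorics using (_C_)
open import Data.Fin.Subset using (Subset; ∣_∣)
open import Data.List using (List; length)

open import Data.Nat using (zero; suc; z≤n; s≤s; z<s; _≤?_; _<?_)
open import Data.Nat.Properties
open import Data.Nat.Combinatorics using (nCk+nC[k+1]≡[n+1]C[k+1])
open import Data.Nat.Solver using (module +-*-Solver)
open import Data.Fin using (Fin; zero; suc)
open import Data.Fin.Subset
  using (inside; outside; ⊥; ⁅_⁆; ∁; _∩_; _∪_; Nonempty)
  renaming (_∈_ to _∈ₛ_; _∉_ to _∉ₛ_; _⊆_ to _⊆ₛ_)
open import Data.Fin.Subset.Properties
  using ( _⊆?_; nonempty?; Empty-unique; ⊥⊆; ∣⊥∣≡0; ∣p∣≤n; p⊆q⇒∣p∣≤∣q∣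
        ; drop-∷-⊆; in⊆in; out⊆; x∈⁅y⁆⇒x≡y; x∈∁p⇒x∉p; ∪-identityʳ; ∩-comm
        ; x∈p∩q⁺; x∈p∩q⁻; p∩q⊆q; x∈p∪q⁻)
open import Data.Vec using ([]; _∷_; here; there)
open import Data.List using ([]; _∷_; [_]; _++_; map; filter; concatMap)
open import Data.List.Properties using (length-map; length-++; length-removeAt′)
open import Data.List.Relation.Unary.All as All using ()
open import Data.List.Relation.Unary.All.Properties using (¬All⇒Any¬)
open import Data.List.Relation.Unary.Any using (here; there; _─_)
open import Data.List.Relation.Unary.AllPairs using (_∷_)
open import Data.List.Relation.Unary.Unique.Propositional using (Unique)
open import Data.List.Relation.Unary.Unique.Propositional.Properties using (filter⁺)
open import Data.List.Relation.Binary.Subset.Propositional using (_⊆_)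
open import Data.List.Membership.Propositional using (_∈_; find; lose)
open import Data.List.Membership.Propositional.Properties
  using (∈-filter⁺; ∈-filter⁻; ∈-map⁺; ∈-map⁻; ∈-++⁺ˡ; ∈-++⁺ʳ; ∈-concatMap⁺)
open import Data.Product using (∃-syntax; _×_; _,_; proj₁; proj₂; map₂)
open import Data.Sum using ([_,_]′)
open import Function using (_∘_)
open import Relation.Nullary using (¬_; yes; no; contradiction)
open import Relation.Binary.PropositionalEquality
  using (_≡_; _≢_; refl; sym; trans; cong; cong₂; subst; subst₂; ≢-sym; module ≡-Reasoning)

private
  variable
    A B : Set
    n : ℕ

∈-─⁺ : ∀ {x y : A} {xs} (x∈xs : x ∈ xs) → y ∈ xs → y ≢ x → y ∈ (xs ─ x∈xs)
∈-─⁺ (here refl)  (here refl)  y≢x = contradiction refl y≢x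
∈-─⁺ (here refl)  (there y∈xs) y≢x = y∈xs
∈-─⁺ (there x∈xs) (here y≡z)   y≢x = here y≡z
∈-─⁺ (there x∈xs) (there y∈xs) y≢x = there (∈-─⁺ x∈xs y∈xs y≢x)

Unique-⊆⇒length≤ : {xs ys : List A} → Unique xs → xs ⊆ ys → length xs ≤ length ys
Unique-⊆⇒length≤ {xs = []}     _               _     = z≤n
Unique-⊆⇒length≤ {xs = x ∷ xs} {ys} (x∉xs ∷ unique) xs⊆ys = begin
  suc (length xs)          ≤⟨ s≤s (Unique-⊆⇒length≤ unique xs⊆ys─x) ⟩
  suc (length (ys ─ x∈ys)) ≡⟨ length-removeAt′ ys _ ⟨
  length ys                ∎
  where
  open ≤-Reasoning
  x∈ys : x ∈ ys
  x∈ys = xs⊆ys (here refl)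
  xs⊆ys─x : xs ⊆ (ys ─ x∈ys)
  xs⊆ys─x y∈xs = ∈-─⁺ x∈ys (xs⊆ys (there y∈xs)) (≢-sym (All.lookup x∉xs y∈xs))

length-concatMap≤ : ∀ {b} (f : A → List B) xs → (∀ {x} → x ∈ xs → length (f x) ≤ b)
  → length (concatMap f xs) ≤ length xs * b
length-concatMap≤ f []       bound = z≤n
length-concatMap≤ f (x ∷ xs) bound = begin
  length (f x ++ concatMap f xs)         ≡⟨ length-++ (f x) ⟩
  length (f x) + length (concatMap f xs) ≤⟨ +-mono-≤ (bound (here refl))
                                                      (length-concatMap≤ f xs (bound ∘ there)) ⟩
  _ + length xs * _                      ∎
  where open ≤-Reasoning

elements : Subset n → List (Fin n)
elements []            = []
elements (inside  ∷ p) = zero ∷ map suc (elements p)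
elements (outside ∷ p) = map suc (elements p)

length-elements : (p : Subset n) → length (elements p) ≡ ∣ p ∣
length-elements []            = refl
length-elements (inside  ∷ p) = cong suc (trans (length-map suc (elements p)) (length-elements p))
length-elements (outside ∷ p) = trans (length-map suc (elements p)) (length-elements p)

∈-elements⁺ : ∀ {x} {p : Subset n} → x ∈ₛ p → x ∈ elements p
∈-elements⁺ {p = inside ∷ p}  here        = here refl
∈-elements⁺ {p = inside ∷ p}  (there x∈p) = there (∈-map⁺ suc (∈-elements⁺ x∈p))
∈-elements⁺ {p = outside ∷ p} (there x∈p) = ∈-map⁺ suc (∈-elements⁺ x∈p)

∈-elements⁻ : ∀ {x} (p : Subset n) → x ∈ elements p → x ∈ₛ p
∈-elements⁻ (inside ∷ p)  (here refl) = here
∈-elements⁻ (inside ∷ p)  (there x∈)  with ∈-map⁻ suc x∈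
... | _ , y∈ , refl = there (∈-elements⁻ p y∈)
∈-elements⁻ (outside ∷ p) x∈          with ∈-map⁻ suc x∈
... | _ , y∈ , refl = there (∈-elements⁻ p y∈)

∪-least : {p q r : Subset n} → p ⊆ₛ r → q ⊆ₛ r → p ∪ q ⊆ₛ r
∪-least {p = p} {q} p⊆r q⊆r = [ p⊆r , q⊆r ]′ ∘ x∈p∪q⁻ p q

x∈p⇒⁅x⁆⊆p : ∀ {x} {p : Subset n} → x ∈ₛ p → ⁅ x ⁆ ⊆ₛ p
x∈p⇒⁅x⁆⊆p {x = x} {p} x∈p y∈⁅x⁆ = subst (_∈ₛ p) (sym (x∈⁅y⁆⇒x≡y x y∈⁅x⁆)) x∈p

0<∣p∣⇒Nonempty : {p : Subset n} → 0 < ∣ p ∣ → Nonempty p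
0<∣p∣⇒Nonempty {n = n} {p = p} 0<∣p∣ with nonempty? p
... | yes nonempty = nonempty
... | no  empty    = contradiction (trans (cong ∣_∣ (Empty-unique empty)) (∣⊥∣≡0 n)) (>⇒≢ 0<∣p∣)

x∉p⇒∣p∪⁅x⁆∣≡1+∣p∣ : ∀ {x} (p : Subset n) → x ∉ₛ p → ∣ p ∪ ⁅ x ⁆ ∣ ≡ suc ∣ p ∣
x∉p⇒∣p∪⁅x⁆∣≡1+∣p∣ {x = zero}  (inside  ∷ p) x∉p = contradiction here x∉p
x∉p⇒∣p∪⁅x⁆∣≡1+∣p∣ {x = zero}  (outside ∷ p) x∉p = cong (suc ∘ ∣_∣) (∪-identityʳ p)
x∉p⇒∣p∪⁅x⁆∣≡1+∣p∣ {x = suc x} (inside  ∷ p) x∉p = cong suc (x∉p⇒∣p∪⁅x⁆∣≡1+∣p∣ p (x∉p ∘ there))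
x∉p⇒∣p∪⁅x⁆∣≡1+∣p∣ {x = suc x} (outside ∷ p) x∉p = x∉p⇒∣p∪⁅x⁆∣≡1+∣p∣ p (x∉p ∘ there)

∣p∪q∣+∣p∩q∣≡∣p∣+∣q∣ : (p q : Subset n) → ∣ p ∪ q ∣ + ∣ p ∩ q ∣ ≡ ∣ p ∣ + ∣ q ∣
∣p∪q∣+∣p∩q∣≡∣p∣+∣q∣ []            []            = refl
∣p∪q∣+∣p∩q∣≡∣p∣+∣q∣ (inside  ∷ p) (inside  ∷ q) =
  cong suc (trans (+-suc _ _) (trans (cong suc (∣p∪q∣+∣p∩q∣≡∣p∣+∣q∣ p q)) (sym (+-suc _ _))))
∣p∪q∣+∣p∩q∣≡∣p∣+∣q∣ (inside  ∷ p) (outside ∷ q) = cong suc (∣p∪q∣+∣p∩q∣≡∣p∣+∣q∣ p q)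
∣p∪q∣+∣p∩q∣≡∣p∣+∣q∣ (outside ∷ p) (inside  ∷ q) =
  trans (cong suc (∣p∪q∣+∣p∩q∣≡∣p∣+∣q∣ p q)) (sym (+-suc _ _))
∣p∪q∣+∣p∩q∣≡∣p∣+∣q∣ (outside ∷ p) (outside ∷ q) = ∣p∪q∣+∣p∩q∣≡∣p∣+∣q∣ p q

∣p∩∁q∣+∣p∩q∣≡∣p∣ : (p q : Subset n) → ∣ p ∩ ∁ q ∣ + ∣ p ∩ q ∣ ≡ ∣ p ∣
∣p∩∁q∣+∣p∩q∣≡∣p∣ []            []            = refl
∣p∩∁q∣+∣p∩q∣≡∣p∣ (inside  ∷ p) (inside  ∷ q) = trans (+-suc _ _) (cong suc (∣p∩∁q∣+∣p∩q∣≡∣p∣ p q))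
∣p∩∁q∣+∣p∩q∣≡∣p∣ (inside  ∷ p) (outside ∷ q) = cong suc (∣p∩∁q∣+∣p∩q∣≡∣p∣ p q)
∣p∩∁q∣+∣p∩q∣≡∣p∣ (outside ∷ p) (_       ∷ q) = ∣p∩∁q∣+∣p∩q∣≡∣p∣ p q

subset-of-size : ∀ {m} (p : Subset n) → m ≤ ∣ p ∣ → ∃[ X ] X ⊆ₛ p × ∣ X ∣ ≡ m
subset-of-size {n} {zero}  p             _         = ⊥ , ⊥⊆ , ∣⊥∣≡0 n
subset-of-size {m = suc m} (inside  ∷ p) (s≤s m≤p) with subset-of-size p m≤p
... | X , X⊆p , ∣X∣≡m = inside ∷ X , in⊆in X⊆p , cong suc ∣X∣≡m
subset-of-size {m = suc m} (outside ∷ p) m≤p       with subset-of-size p m≤p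
... | X , X⊆p , ∣X∣≡m = outside ∷ X , out⊆ X⊆p , ∣X∣≡m

supersets : Subset n → ℕ → List (Subset n)
supersets []            zero    = [ [] ]
supersets []            (suc j) = []
supersets (inside  ∷ p) j       = map (inside ∷_) (supersets p j)
supersets (outside ∷ p) zero    = map (outside ∷_) (supersets p zero)
supersets (outside ∷ p) (suc j) =
  map (outside ∷_) (supersets p (suc j)) ++ map (inside ∷_) (supersets p j)

length-supersets : (p : Subset n) (j : ℕ) → length (supersets p j) ≡ (n ∸ ∣ p ∣) C j
length-supersets []            zero    = refl
length-supersets []            (suc j) = refl
length-supersets (inside  ∷ p) j       = trans (length-map _ (supersets p j)) (length-supersets p j)
length-supersets (outside ∷ p) zero    =
  trans (length-map _ (supersets p zero)) (length-supersets p zero)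
length-supersets {suc n} (outside ∷ p) (suc j) = begin
  length (map (outside ∷_) (supersets p (suc j)) ++ map (inside ∷_) (supersets p j))
    ≡⟨ length-++ (map (outside ∷_) (supersets p (suc j))) ⟩
  length (map (outside ∷_) (supersets p (suc j))) + length (map (inside ∷_) (supersets p j))
    ≡⟨ cong₂ _+_ (trans (length-map _ (supersets p (suc j))) (length-supersets p (suc j)))
                 (trans (length-map _ (supersets p j)) (length-supersets p j)) ⟩
  (n ∸ ∣ p ∣) C suc j + (n ∸ ∣ p ∣) C j
    ≡⟨ +-comm ((n ∸ ∣ p ∣) C suc j) _ ⟩
  (n ∸ ∣ p ∣) C j + (n ∸ ∣ p ∣) C suc j
    ≡⟨ nCk+nC[k+1]≡[n+1]C[k+1] (n ∸ ∣ p ∣) j ⟩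
  suc (n ∸ ∣ p ∣) C suc j
    ≡⟨ cong (_C suc j) (+-∸-assoc 1 (∣p∣≤n p)) ⟨
  (suc n ∸ ∣ p ∣) C suc j ∎
  where open ≡-Reasoning

∈-supersets⁺ : ∀ {p F : Subset n} j → p ⊆ₛ F → ∣ F ∣ ≡ ∣ p ∣ + j → F ∈ supersets p j
∈-supersets⁺ {p = []}          {[]}          zero    _   _ = here refl
∈-supersets⁺ {p = inside  ∷ p} {inside  ∷ F} j       p⊆F ∣F∣≡ =
  ∈-map⁺ _ (∈-supersets⁺ j (drop-∷-⊆ p⊆F) (suc-injective ∣F∣≡))
∈-supersets⁺ {p = inside  ∷ p} {outside ∷ F} j       p⊆F _ with p⊆F here
... | ()
∈-supersets⁺ {p = outside ∷ p} {outside ∷ F} zero    p⊆F ∣F∣≡ =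
  ∈-map⁺ _ (∈-supersets⁺ zero (drop-∷-⊆ p⊆F) ∣F∣≡)
∈-supersets⁺ {p = outside ∷ p} {outside ∷ F} (suc j) p⊆F ∣F∣≡ =
  ∈-++⁺ˡ (∈-map⁺ _ (∈-supersets⁺ (suc j) (drop-∷-⊆ p⊆F) ∣F∣≡))
∈-supersets⁺ {p = outside ∷ p} {inside  ∷ F} zero    p⊆F ∣F∣≡ =
  contradiction (trans ∣F∣≡ (+-identityʳ _)) (>⇒≢ (s≤s (p⊆q⇒∣p∣≤∣q∣ (drop-∷-⊆ p⊆F))))
∈-supersets⁺ {p = outside ∷ p} {inside  ∷ F} (suc j) p⊆F ∣F∣≡ =
  ∈-++⁺ʳ (map (outside ∷_) (supersets p (suc j)))
    (∈-map⁺ _ (∈-supersets⁺ j (drop-∷-⊆ p⊆F) (suc-injective (trans ∣F∣≡ (+-suc _ j)))))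

length-restrict≤C : ∀ {k} {𝓕 : List (Subset n)} → KUniform k 𝓕 → (H : Subset n) → ∣ H ∣ ≤ k
  → length (restrict 𝓕 H) ≤ (n ∸ ∣ H ∣) C (k ∸ ∣ H ∣)
length-restrict≤C {k = k} {𝓕} (unique , uniform) H ∣H∣≤k = begin
  length (restrict 𝓕 H)              ≤⟨ Unique-⊆⇒length≤ (filter⁺ (H ⊆?_) unique) 𝓕_H⊆supersets ⟩
  length (supersets H (k ∸ ∣ H ∣))    ≡⟨ length-supersets H (k ∸ ∣ H ∣) ⟩
  (_ ∸ ∣ H ∣) C (k ∸ ∣ H ∣)           ∎
  where
  open ≤-Reasoning
  𝓕_H⊆supersets : restrict 𝓕 H ⊆ supersets H (k ∸ ∣ H ∣)
  𝓕_H⊆supersets F∈𝓕_H with ∈-filter⁻ (H ⊆?_) F∈𝓕_H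
  ... | F∈𝓕 , H⊆F =
    ∈-supersets⁺ (k ∸ ∣ H ∣) H⊆F (trans (All.lookup uniform F∈𝓕) (sym (m+[n∸m]≡n ∣H∣≤k)))

meets-large-⊆ : ∀ {t} {A X : Subset n} (F : Subset n) → X ⊆ₛ A → ∣ A ∣ < ∣ X ∣ + t
  → t ≤ ∣ F ∩ A ∣ → Nonempty (F ∩ X)
meets-large-⊆ {t = t} {A} {X} F X⊆A ∣A∣<∣X∣+t t≤∣F∩A∣ =
  map₂ shrink (0<∣p∣⇒Nonempty (+-cancelˡ-< (∣ F ∩ A ∪ X ∣) 0 _ counted-twice))
  where
  open ≤-Reasoning
  counted-twice : ∣ F ∩ A ∪ X ∣ + 0 < ∣ F ∩ A ∪ X ∣ + ∣ (F ∩ A) ∩ X ∣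
  counted-twice = begin-strict
    ∣ F ∩ A ∪ X ∣ + 0                  ≡⟨ +-identityʳ _ ⟩
    ∣ F ∩ A ∪ X ∣                      ≤⟨ p⊆q⇒∣p∣≤∣q∣ (∪-least (p∩q⊆q F A) X⊆A) ⟩
    ∣ A ∣                              <⟨ ∣A∣<∣X∣+t ⟩
    ∣ X ∣ + t                          ≤⟨ +-monoʳ-≤ ∣ X ∣ t≤∣F∩A∣ ⟩
    ∣ X ∣ + ∣ F ∩ A ∣                  ≡⟨ +-comm ∣ X ∣ _ ⟩
    ∣ F ∩ A ∣ + ∣ X ∣                  ≡⟨ ∣p∪q∣+∣p∩q∣≡∣p∣+∣q∣ (F ∩ A) X ⟨
    ∣ F ∩ A ∪ X ∣ + ∣ (F ∩ A) ∩ X ∣    ∎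
  shrink : ∀ {x} → x ∈ₛ (F ∩ A) ∩ X → x ∈ₛ F ∩ X
  shrink x∈ with x∈p∩q⁻ (F ∩ A) X x∈
  ... | x∈F∩A , x∈X = x∈p∩q⁺ (proj₁ (x∈p∩q⁻ F A x∈F∩A) , x∈X)

transversal : ∀ {t m} (F₀ H : Subset n) → m + ∣ H ∩ F₀ ∣ ≤ ∣ F₀ ∣ → ∣ F₀ ∣ < m + t
  → ∃[ X ] X ⊆ₛ F₀ ∩ ∁ H × ∣ X ∣ ≡ m × (∀ F → t ≤ ∣ F ∩ F₀ ∣ → Nonempty (F ∩ X))
transversal {t = t} {m} F₀ H m+∣H∩F₀∣≤∣F₀∣ ∣F₀∣<m+t with subset-of-size (F₀ ∩ ∁ H) m≤∣F₀∖H∣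
  where
  m≤∣F₀∖H∣ : m ≤ ∣ F₀ ∩ ∁ H ∣
  m≤∣F₀∖H∣ = +-cancelʳ-≤ ∣ F₀ ∩ H ∣ m _ (begin
    m + ∣ F₀ ∩ H ∣              ≡⟨ cong (m +_) (cong ∣_∣ (∩-comm F₀ H)) ⟩
    m + ∣ H ∩ F₀ ∣              ≤⟨ m+∣H∩F₀∣≤∣F₀∣ ⟩
    ∣ F₀ ∣                      ≡⟨ ∣p∩∁q∣+∣p∩q∣≡∣p∣ F₀ H ⟨
    ∣ F₀ ∩ ∁ H ∣ + ∣ F₀ ∩ H ∣    ∎)
    where open ≤-Reasoning
... | X , X⊆F₀∖H , ∣X∣≡m = X , X⊆F₀∖H , ∣X∣≡m , λ F →
  meets-large-⊆ F (λ x∈X → proj₁ (x∈p∩q⁻ F₀ (∁ H) (X⊆F₀∖H x∈X)))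
    (subst (λ l → ∣ F₀ ∣ < l + t) (sym ∣X∣≡m) ∣F₀∣<m+t)

length-restrict≤-branching : ∀ {t b} {𝓕 : List (Subset n)} → Unique 𝓕 → (H F₀ X : Subset n)
  → (∀ F → t ≤ ∣ F ∩ F₀ ∣ → Nonempty (F ∩ X))
  → (∀ {x} → x ∈ₛ X → length (restrict 𝓕 (H ∪ ⁅ x ⁆)) ≤ b)
  → length (restrict 𝓕 H) ≤ badCount t 𝓕 F₀ + ∣ X ∣ * b
length-restrict≤-branching {n = n} {t = t} {b} {𝓕} unique H F₀ X meets bound = begin
  length (restrict 𝓕 H)                     ≤⟨ Unique-⊆⇒length≤ (filter⁺ (H ⊆?_) unique) 𝓕_H⊆ ⟩
  length (bad ++ branches)                  ≡⟨ length-++ bad ⟩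
  badCount t 𝓕 F₀ + length branches         ≤⟨ +-monoʳ-≤ _ (length-concatMap≤ branch (elements X)
                                                                (bound ∘ ∈-elements⁻ X)) ⟩
  badCount t 𝓕 F₀ + length (elements X) * b ≡⟨ cong (λ l → _ + l * b) (length-elements X) ⟩
  badCount t 𝓕 F₀ + ∣ X ∣ * b               ∎
  where
  open ≤-Reasoning
  bad : List (Subset n)
  bad = filter (λ F → ∣ F ∩ F₀ ∣ <? t) 𝓕
  branch : Fin n → List (Subset n)
  branch x = restrict 𝓕 (H ∪ ⁅ x ⁆)
  branches : List (Subset n)
  branches = concatMap branch (elements X)
  𝓕_H⊆ : restrict 𝓕 H ⊆ bad ++ branches
  𝓕_H⊆ {F} F∈𝓕_H with ∈-filter⁻ (H ⊆?_) {xs = 𝓕} F∈𝓕_H | ∣ F ∩ F₀ ∣ <? t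
  ... | F∈𝓕 , _   | yes F-bad = ∈-++⁺ˡ (∈-filter⁺ (λ G → ∣ G ∩ F₀ ∣ <? t) F∈𝓕 F-bad)
  ... | F∈𝓕 , H⊆F | no  F-good with meets F (≮⇒≥ F-good)
  ...   | x , x∈F∩X with x∈p∩q⁻ F X x∈F∩X
  ...     | x∈F , x∈X = ∈-++⁺ʳ bad (∈-concatMap⁺ branch (lose (∈-elements⁺ x∈X)
                          (∈-filter⁺ (H ∪ ⁅ x ⁆ ⊆?_) F∈𝓕 (∪-least H⊆F (x∈p⇒⁅x⁆⊆p x∈F)))))

uncovered-member : ∀ {t} {𝓕 : List (Subset n)} {T} → ¬ IsTCover t 𝓕 T → ∃[ F ] F ∈ 𝓕 × ∣ T ∩ F ∣ < t
uncovered-member {t = t} {𝓕} {T} ¬cover =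
  map₂ (map₂ ≰⇒>) (find (¬All⇒Any¬ (λ F → t ≤? ∣ T ∩ F ∣) 𝓕 ¬cover))

geomSum-suc : ∀ s q m → geomSum s q (suc m) ≡ s + q * geomSum s q m
geomSum-suc s q zero    = solve 2 (λ s q → con 0 :+ s :* con 1 := s :+ q :* con 0) refl s q
  where open +-*-Solver
geomSum-suc s q (suc m) = begin
  geomSum s q (suc m) + s * q ^ suc m     ≡⟨ cong (_+ s * q ^ suc m) (geomSum-suc s q m) ⟩
  s + q * geomSum s q m + s * (q * q ^ m) ≡⟨ solve 4 (λ s q g p → s :+ q :* g :+ s :* (q :* p)
                                                       := s :+ q :* (g :+ s :* p))
                                               refl s q (geomSum s q m) (q ^ m) ⟩
  s + q * geomSum s q (suc m)             ∎
  where open ≡-Reasoning; open +-*-Solver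

^*+geomSum-suc : ∀ s q c m
  → q ^ suc m * c + geomSum s q (suc m) ≡ s + q * (q ^ m * c + geomSum s q m)
^*+geomSum-suc s q c m = begin
  q * q ^ m * c + geomSum s q (suc m)     ≡⟨ cong (q * q ^ m * c +_) (geomSum-suc s q m) ⟩
  q * q ^ m * c + (s + q * geomSum s q m) ≡⟨ solve 5 (λ s q p c g → q :* p :* c :+ (s :+ q :* g)
                                                       := s :+ q :* (p :* c :+ g))
                                               refl s q (q ^ m) c (geomSum s q m) ⟩
  s + q * (q ^ m * c + geomSum s q m)     ∎
  where open ≡-Reasoning; open +-*-Solver

module _ {k t s τ : ℕ} {𝓕 : List (Subset n)} (uniform : KUniform k 𝓕)
         (almost : AlmostIntersecting s t 𝓕) (τ-minimal : ∀ T → IsTCover t 𝓕 T → τ ≤ ∣ T ∣)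
         (t≤k : t ≤ k) (τ≤k : τ ≤ k) where

  private
    q c : ℕ
    q = k ∸ t + 1
    c = (n ∸ τ) C (k ∸ τ)

    q+t≡1+k : q + t ≡ suc k
    q+t≡1+k = begin
      k ∸ t + 1 + t   ≡⟨ +-comm (k ∸ t + 1) t ⟩
      t + (k ∸ t + 1) ≡⟨ +-assoc t (k ∸ t) 1 ⟨
      t + (k ∸ t) + 1 ≡⟨ cong (_+ 1) (m+[n∸m]≡n t≤k) ⟩
      k + 1           ≡⟨ +-comm k 1 ⟩
      suc k           ∎
      where open ≡-Reasoning

    q+a≤k : ∀ {a} → a < t → q + a ≤ k
    q+a≤k {a} a<t = begin
      k ∸ t + 1 + a   ≡⟨ +-assoc (k ∸ t) 1 a ⟩
      k ∸ t + suc a   ≤⟨ +-monoʳ-≤ (k ∸ t) a<t ⟩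
      k ∸ t + t       ≡⟨ m∸n+n≡m t≤k ⟩
      k               ∎
      where open ≤-Reasoning

  length-restrict≤ : ∀ m H → ∣ H ∣ + m ≡ τ
    → length (restrict 𝓕 H) ≤ q ^ m * c + geomSum s q m
  length-restrict≤ zero H ∣H∣+0≡τ = begin
    length (restrict 𝓕 H)       ≤⟨ length-restrict≤C uniform H (subst (_≤ k) (sym ∣H∣≡τ) τ≤k) ⟩
    (n ∸ ∣ H ∣) C (k ∸ ∣ H ∣)   ≡⟨ cong (λ h → (n ∸ h) C (k ∸ h)) ∣H∣≡τ ⟩
    c                           ≡⟨ trans (+-identityʳ (1 * c)) (*-identityˡ c) ⟨
    1 * c + 0                   ∎
    where
    open ≤-Reasoning
    ∣H∣≡τ : ∣ H ∣ ≡ τ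
    ∣H∣≡τ = trans (sym (+-identityʳ _)) ∣H∣+0≡τ
  length-restrict≤ (suc m) H ∣H∣+1+m≡τ
    with uncovered-member {T = H} (<⇒≱ ∣H∣<τ ∘ τ-minimal H)
    where
    ∣H∣<τ : ∣ H ∣ < τ
    ∣H∣<τ = subst (∣ H ∣ <_) ∣H∣+1+m≡τ (m<m+n ∣ H ∣ z<s)
  ... | F₀ , F₀∈𝓕 , ∣H∩F₀∣<t
    with transversal F₀ H (subst (q + ∣ H ∩ F₀ ∣ ≤_) (sym ∣F₀∣≡k) (q+a≤k ∣H∩F₀∣<t))
                          (subst₂ _<_ (sym ∣F₀∣≡k) (sym q+t≡1+k) ≤-refl)
    where
    ∣F₀∣≡k : ∣ F₀ ∣ ≡ k
    ∣F₀∣≡k = All.lookup (proj₂ uniform) F₀∈𝓕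
  ... | X , X⊆F₀∖H , ∣X∣≡q , meets = begin
    length (restrict 𝓕 H)        ≤⟨ length-restrict≤-branching (proj₁ uniform) H F₀ X
                                                                meets branch≤ ⟩
    badCount t 𝓕 F₀ + ∣ X ∣ * b  ≤⟨ +-monoˡ-≤ (∣ X ∣ * b) (almost F₀ F₀∈𝓕) ⟩
    s + ∣ X ∣ * b                ≡⟨ cong (λ l → s + l * b) ∣X∣≡q ⟩
    s + q * b                    ≡⟨ ^*+geomSum-suc s q c m ⟨
    q ^ suc m * c + geomSum s q (suc m) ∎
    where
    open ≤-Reasoning
    b : ℕ
    b = q ^ m * c + geomSum s q m
    branch≤ : ∀ {x} → x ∈ₛ X → length (restrict 𝓕 (H ∪ ⁅ x ⁆)) ≤ b
    branch≤ {x} x∈X = length-restrict≤ m (H ∪ ⁅ x ⁆) (begin-equality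
      ∣ H ∪ ⁅ x ⁆ ∣ + m   ≡⟨ cong (_+ m) (x∉p⇒∣p∪⁅x⁆∣≡1+∣p∣ H x∉H) ⟩
      suc ∣ H ∣ + m       ≡⟨ +-suc ∣ H ∣ m ⟨
      ∣ H ∣ + suc m       ≡⟨ ∣H∣+1+m≡τ ⟩
      τ                   ∎)
      where
      x∉H : x ∉ₛ H
      x∉H = x∈∁p⇒x∉p (proj₂ (x∈p∩q⁻ F₀ (∁ H) (X⊆F₀∖H x∈X)))

proposition3p2 : (n k t s : ℕ) → 1 ≤ n → 1 ≤ k → 1 ≤ t → 1 ≤ s
    → t + 1 ≤ k → (t + 1) * ((k ∸ t + 1) ^ 2) ≤ n
    → (𝓕 : List (Subset n)) → KUniform k 𝓕 → AlmostIntersecting s t 𝓕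
    → (τ : ℕ) → IsTCoveringNumber t 𝓕 τ → t + 1 ≤ τ → τ ≤ k
    → (H : Subset n) → ∣ H ∣ < τ
    → length (restrict 𝓕 H)
      ≤ (k ∸ t + 1) ^ (τ ∸ ∣ H ∣) * ((n ∸ τ) C (k ∸ τ))
        + geomSum s (k ∸ t + 1) (τ ∸ ∣ H ∣)
proposition3p2 n k t s _ _ _ _ t+1≤k _ 𝓕 uniform almost τ (_ , τ-minimal) _ τ≤k H ∣H∣<τ =
  length-restrict≤ uniform almost τ-minimal (≤-trans (m≤m+n t 1) t+1≤k) τ≤k
    (τ ∸ ∣ H ∣) H (m+[n∸m]≡n (<⇒≤ ∣H∣<τ))
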